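{- Let $G$ be a graph of order $n$ with $\chi_D(G)=n$. Then $\chi_D(G\cup G)=n+1$ if $G\cong K_n$; $\chi_D(G\cup G)=2n$ if $G\cong\overline{K_n}$; and $\chi_D(G\cup G)=n$ otherwise.
   Context: $G\cup G$ is the disjoint union of two copies of $G$. A distinguishing $k$-coloring of a graph is a partition of its vertex set into exactly $k$ non-empty independent sets such that the only automorphism mapping every class onto itself is the identity; $\chi_D$ is the least such $k$. $\overline{K_n}$ is the edgeless graph on $n$ vertices. -}

module Defs where

open import Data.Nat using (ℕ; _+_; _≤_)
open import Data.Bool using (Bool; true; false)
open import Data.Fin using (Fin; splitAt)
open import Data.Fin.Permutation using (Permutation; Permutation′; _⟨$⟩ʳ_)
open import Data.Sum using (_⊎_; inj₁; inj₂)
open import Data.Product using (Σ; ∃; _×_)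
open import Relation.Binary.PropositionalEquality using (_≡_; _≢_)
open import Relation.Nullary using (¬_)

record Graph (n : ℕ) : Set where
  field
    adj   : Fin n → Fin n → Bool
    sym   : ∀ x y → adj x y ≡ adj y x
    irrefl : ∀ x → adj x x ≡ false
open Graph public

complete : (n : ℕ) → Graph n
complete n = record { adj = λ x y → neq x y ; sym = s ; irrefl = i }
  where
  open import Data.Fin using (_≟_)
  open import Relation.Nullary using (yes; no)
  open import Relation.Binary.PropositionalEquality using (refl)
  neq : Fin n → Fin n → Bool
  neq x y with x ≟ y
  ... | yes _ = false
  ... | no _ = true
  s : ∀ x y → neq x y ≡ neq y x
  s x y with x ≟ y | y ≟ x
  ... | yes _ | yes _ = refl
  ... | no _ | no _ = refl
  ... | yes refl | no q = Data.Empty.⊥-elim (q refl) where import Data.Empty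
  ... | no p | yes refl = Data.Empty.⊥-elim (p refl) where import Data.Empty
  i : ∀ x → neq x x ≡ false
  i x with x ≟ x
  ... | yes _ = refl
  ... | no p = Data.Empty.⊥-elim (p refl) where import Data.Empty

edgeless : (n : ℕ) → Graph n
edgeless n = record { adj = λ _ _ → false ; sym = λ _ _ → refl ; irrefl = λ _ → refl }
  where open import Relation.Binary.PropositionalEquality using (refl)

-- Disjoint union G ∪ H on Fin (m + n): first m vertices from G, the rest from H.
unionAdj : ∀ {m n} → Graph m → Graph n → Fin m ⊎ Fin n → Fin m ⊎ Fin n → Bool
unionAdj G H (inj₁ x) (inj₁ y) = adj G x y
unionAdj G H (inj₂ x) (inj₂ y) = adj H x y
unionAdj G H (inj₁ _) (inj₂ _) = false
unionAdj G H (inj₂ _) (inj₁ _) = false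

_∪ᵍ_ : ∀ {m n} → Graph m → Graph n → Graph (m + n)
_∪ᵍ_ {m} {n} G H = record
  { adj = λ x y → unionAdj G H (splitAt m x) (splitAt m y)
  ; sym = λ x y → s (splitAt m x) (splitAt m y)
  ; irrefl = λ x → i (splitAt m x) }
  where
  open import Relation.Binary.PropositionalEquality using (refl)
  s : ∀ a b → unionAdj G H a b ≡ unionAdj G H b a
  s (inj₁ x) (inj₁ y) = Graph.sym G x y
  s (inj₂ x) (inj₂ y) = Graph.sym H x y
  s (inj₁ _) (inj₂ _) = refl
  s (inj₂ _) (inj₁ _) = refl
  i : ∀ a → unionAdj G H a a ≡ false
  i (inj₁ x) = Graph.irrefl G x
  i (inj₂ x) = Graph.irrefl H x

_≅ᵍ_ : ∀ {n} → Graph n → Graph n → Set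
_≅ᵍ_ {n} G H = Σ (Permutation′ n) λ π → ∀ x y → adj H (π ⟨$⟩ʳ x) (π ⟨$⟩ʳ y) ≡ adj G x y

Automorphism : ∀ {n} → Graph n → Set
Automorphism G = G ≅ᵍ G

-- A distinguishing k-coloring: a map c into Fin k that is surjective
-- (exactly k non-empty classes), proper (classes are independent sets), and
-- such that every automorphism fixing each colour class is the identity.
record DistColoring {n : ℕ} (G : Graph n) (k : ℕ) : Set where
  field
    col        : Fin n → Fin k
    surjective : ∀ (i : Fin k) → ∃ λ x → col x ≡ i
    proper     : ∀ x y → adj G x y ≡ true → col x ≢ col y
    distinguishing : ∀ (σ : Automorphism G) →
                     (∀ x → col (Data.Product.proj₁ σ ⟨$⟩ʳ x) ≡ col x) →
                     ∀ x → Data.Product.proj₁ σ ⟨$⟩ʳ x ≡ x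

IsChiD : ∀ {n} → Graph n → ℕ → Set
IsChiD G m = DistColoring G m × (∀ k → DistColoring G k → m ≤ k)

-- If χ_D(G) equals the order of G, any two non-adjacent vertices x, y are twins: a vertex z
-- separating them would make the colouring that gives y the colour of x and every other
-- vertex its own colour distinguishing, since a colour-preserving automorphism fixes z and
-- hence cannot exchange x and y.  Twins always receive distinct colours in a distinguishing
-- colouring (their transposition is an automorphism), so a distinguishing colouring of G ∪ G
-- is injective on each copy, and on all of it when G is edgeless.  For K_n, n colours would
-- biject each copy onto the colours, and exchanging the copies along this matching preserves
-- colours; n + 1 colours suffice.  Otherwise take non-adjacent a, b and a neighbour v of a,
-- and colour the first copy by the identity and the second by the transposition (a v): an
-- automorphism moving one vertex to the other copy moves all of them, so preserving colours
-- it sends a to v and b to b, turning the non-edge ab into the edge vb.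

module Submission where

open import Defs hiding (sym)
open import Data.Nat using (ℕ; suc; _+_; _*_; _≥_; _≤_)
import Data.Nat.Properties as ℕ
open import Data.Bool using (true; false)
import Data.Bool.Properties as Bool
open import Data.Fin
  using (Fin; zero; suc; splitAt; join; _↑ˡ_; _↑ʳ_; punchIn; punchOut; inject₁; _≟_)
open import Data.Fin.Properties
  using ( punchOut-cong; punchOut-injective; punchOut-punchIn; punchInᵢ≢i; any?; injective⇒≤
        ; splitAt-join; join-splitAt; +↔⊎; ↑ˡ-injective; ↑ʳ-injective
        ; inject₁-injective; suc-injective)
open import Data.Fin.Permutation
  using (Permutation′; permutation; transpose; id; flip; _∘ₚ_; _⟨$⟩ʳ_; _⟨$⟩ˡ_; inverseˡ; inverseʳ)
import Data.Fin.Permutation.Components as PC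
open import Data.Sum using (_⊎_; inj₁; inj₂; [_,_]′)
open import Data.Product using (∃; ∃₂; _×_; _,_; proj₁; proj₂)
open import Data.Empty using (⊥-elim)
open import Function using (_∘_)
open import Function.Bundles using (Injection)
open import Function.Construct.Symmetry using (↔-sym)
open import Function.Definitions using (Injective; StrictlySurjective)
open import Function.Properties.Inverse using (↔⇒↣)
open import Relation.Nullary using (¬_; yes; no)
open import Relation.Nullary.Decidable using (dec-true; dec-false; ¬?; _×-dec_)
open import Relation.Binary.PropositionalEquality
open ≡-Reasoning

private
  variable
    k m n : ℕ

false≢true : false ≢ true
false≢true ()

adj≡true⇒≢ : (G : Graph n) {x y : Fin n} → adj G x y ≡ true → x ≢ y
adj≡true⇒≢ G {x} xy refl = false≢true (trans (sym (irrefl G x)) xy)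

permutation-injective : (π : Permutation′ n) → Injective _≡_ _≡_ (π ⟨$⟩ʳ_)
permutation-injective π = Injection.injective (↔⇒↣ π)

splitAt-injective : Injective _≡_ _≡_ (splitAt m {n})
splitAt-injective = Injection.injective (↔⇒↣ +↔⊎)

join-injective : Injective _≡_ _≡_ (join m n)
join-injective = Injection.injective (↔⇒↣ (↔-sym +↔⊎))

injective⇒surjective : {f : Fin n → Fin n} → Injective _≡_ _≡_ f → StrictlySurjective _≡_ f
injective⇒surjective {suc n} {f} f-inj i with any? (λ j → f j ≟ i)
... | yes hit   = hit
... | no missed = ⊥-elim (ℕ.n≮n n (injective⇒≤ avoid-i-injective))
  where
  i≢f : ∀ j → i ≢ f j
  i≢f j i≡fj = missed (j , sym i≡fj)
  avoid-i : Fin (suc n) → Fin n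
  avoid-i j = punchOut (i≢f j)
  avoid-i-injective : Injective _≡_ _≡_ avoid-i
  avoid-i-injective {x} {y} = f-inj ∘ punchOut-injective (i≢f x) (i≢f y)

injective⇒permutation : {f : Fin n → Fin n} → Injective _≡_ _≡_ f → Permutation′ n
injective⇒permutation {f = f} f-inj =
  permutation f (proj₁ ∘ surjective) (proj₂ ∘ surjective) (λ x → f-inj (proj₂ (surjective (f x))))
  where surjective = injective⇒surjective f-inj

Twins : Graph n → Fin n → Fin n → Set
Twins G p q = ∀ z → adj G p z ≡ adj G q z

NonadjacentTwins : Graph n → Set
NonadjacentTwins G = ∀ x y → adj G x y ≡ false → Twins G x y

module _ {p q : Fin n} where

  transpose-p : PC.transpose p q p ≡ q
  transpose-p rewrite dec-true (p ≟ p) refl = refl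

  transpose-q : PC.transpose p q q ≡ p
  transpose-q with q ≟ p
  ... | yes q≡p = q≡p
  ... | no _ rewrite dec-true (q ≟ q) refl = refl

  transpose-other : ∀ {x} → x ≢ p → x ≢ q → PC.transpose p q x ≡ x
  transpose-other {x} x≢p x≢q rewrite dec-false (x ≟ p) x≢p | dec-false (x ≟ q) x≢q = refl

  transpose-cases : ∀ x → (x ≡ p × PC.transpose p q x ≡ q) ⊎ (x ≡ q × PC.transpose p q x ≡ p)
                          ⊎ PC.transpose p q x ≡ x
  transpose-cases x with x ≟ p
  ... | yes x≡p = inj₁ (x≡p , refl)
  ... | no _ with x ≟ q
  ...   | yes x≡q = inj₂ (inj₁ (x≡q , refl))
  ...   | no _    = inj₂ (inj₂ refl)

  transpose-preserves : {A : Set} (f : Fin n → A) → f p ≡ f q → ∀ x → f (PC.transpose p q x) ≡ f x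
  transpose-preserves f fp≡fq x with transpose-cases x
  ... | inj₁ (refl , τx≡q)        = trans (cong f τx≡q) (sym fp≡fq)
  ... | inj₂ (inj₁ (refl , τx≡p)) = trans (cong f τx≡p) fp≡fq
  ... | inj₂ (inj₂ τx≡x)          = cong f τx≡x

  twins-transposition : (G : Graph n) → Twins G p q → Automorphism G
  twins-transposition G twins = transpose p q , λ x y → begin
      adj G (τ x) (τ y) ≡⟨ swap-twin x (τ y) ⟩
      adj G x (τ y)     ≡⟨ Graph.sym G x (τ y) ⟩
      adj G (τ y) x     ≡⟨ swap-twin y x ⟩
      adj G y x         ≡⟨ Graph.sym G y x ⟩
      adj G x y         ∎
    where
    τ = PC.transpose p q
    swap-twin : ∀ x z → adj G (τ x) z ≡ adj G x z
    swap-twin x z = transpose-preserves (λ w → adj G w z) (twins z) x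

module _ {G : Graph n} (D : DistColoring G k) where
  open DistColoring D

  same-colour⇒nonadjacent : ∀ {x y} → col x ≡ col y → adj G x y ≡ false
  same-colour⇒nonadjacent {x} {y} cx≡cy with adj G x y in xy
  ... | false = refl
  ... | true  = ⊥-elim (proper x y xy cx≡cy)

  twins-coloured-apart : ∀ {p q} → Twins G p q → col p ≡ col q → p ≡ q
  twins-coloured-apart {p} {q} twins cp≡cq = trans
    (sym (distinguishing (twins-transposition G twins) (transpose-preserves col cp≡cq) p))
    (transpose-p {p = p} {q})

module Merge {x y : Fin (suc m)} (y≢x : y ≢ x) where

  retract : Fin (suc m) → Fin (suc m)
  retract w with w ≟ y
  ... | yes _ = x
  ... | no _  = w

  retract-cases : ∀ w → (w ≡ y × retract w ≡ x) ⊎ (w ≢ y × retract w ≡ w)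
  retract-cases w with w ≟ y
  ... | yes w≡y = inj₁ (w≡y , refl)
  ... | no w≢y  = inj₂ (w≢y , refl)

  y≢retract : ∀ w → y ≢ retract w
  y≢retract w with retract-cases w
  ... | inj₁ (_ , rw≡x)   = subst (y ≢_) (sym rw≡x) y≢x
  ... | inj₂ (w≢y , rw≡w) = subst (y ≢_) (sym rw≡w) (w≢y ∘ sym)

  merge : Fin (suc m) → Fin m
  merge w = punchOut (y≢retract w)

  merge-surjective : StrictlySurjective _≡_ merge
  merge-surjective i = punchIn y i , trans (punchOut-cong y retract-punchIn) (punchOut-punchIn y)
    where
    retract-punchIn : retract (punchIn y i) ≡ punchIn y i
    retract-punchIn with retract-cases (punchIn y i)
    ... | inj₁ (punchIn≡y , _) = ⊥-elim (punchInᵢ≢i y i punchIn≡y)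
    ... | inj₂ (_ , r≡)       = r≡

  merge-fibres : ∀ {a b} → merge a ≡ merge b → a ≡ b ⊎ (a ≡ x × b ≡ y) ⊎ (a ≡ y × b ≡ x)
  merge-fibres {a} {b} ma≡mb
    with retract-cases a | retract-cases b | punchOut-injective (y≢retract a) (y≢retract b) ma≡mb
  ... | inj₁ (a≡y , _)    | inj₁ (b≡y , _)    | _     = inj₁ (trans a≡y (sym b≡y))
  ... | inj₁ (a≡y , ra≡x) | inj₂ (_ , rb≡b)   | ra≡rb =
    inj₂ (inj₂ (a≡y , trans (sym rb≡b) (trans (sym ra≡rb) ra≡x)))
  ... | inj₂ (_ , ra≡a)   | inj₁ (b≡y , rb≡x) | ra≡rb =
    inj₂ (inj₁ (trans (sym ra≡a) (trans ra≡rb rb≡x) , b≡y))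
  ... | inj₂ (_ , ra≡a)   | inj₂ (_ , rb≡b)   | ra≡rb = inj₁ (trans (sym ra≡a) (trans ra≡rb rb≡b))

  merged-colouring : (G : Graph (suc m)) → adj G x y ≡ false →
                     ∀ z → adj G x z ≢ adj G y z → DistColoring G m
  merged-colouring G xy z xz≢yz = record
    { col            = merge
    ; surjective     = merge-surjective
    ; proper         = proper
    ; distinguishing = distinguishing
    }
    where
    yx : adj G y x ≡ false
    yx = trans (Graph.sym G y x) xy

    proper : ∀ a b → adj G a b ≡ true → merge a ≢ merge b
    proper a b ab ma≡mb with merge-fibres ma≡mb
    ... | inj₁ a≡b                  = adj≡true⇒≢ G ab a≡b
    ... | inj₂ (inj₁ (refl , refl)) = false≢true (trans (sym xy) ab)
    ... | inj₂ (inj₂ (refl , refl)) = false≢true (trans (sym yx) ab)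

    z≢x : z ≢ x
    z≢x refl = xz≢yz (trans (irrefl G z) (sym yx))

    z≢y : z ≢ y
    z≢y refl = xz≢yz (trans xy (sym (irrefl G z)))

    distinguishing : ∀ (σ : Automorphism G) → (∀ w → merge (proj₁ σ ⟨$⟩ʳ w) ≡ merge w) →
                     ∀ w → proj₁ σ ⟨$⟩ʳ w ≡ w
    distinguishing (π , π-adj) pres = fixed
      where
      fixes-z : π ⟨$⟩ʳ z ≡ z
      fixes-z with merge-fibres (pres z)
      ... | inj₁ πz≡z             = πz≡z
      ... | inj₂ (inj₁ (_ , z≡y)) = ⊥-elim (z≢y z≡y)
      ... | inj₂ (inj₂ (_ , z≡x)) = ⊥-elim (z≢x z≡x)

      fixed : ∀ w → π ⟨$⟩ʳ w ≡ w
      fixed w with merge-fibres (pres w)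
      ... | inj₁ πw≡w                  = πw≡w
      ... | inj₂ (inj₁ (πy≡x , refl)) =
        ⊥-elim (xz≢yz (trans (sym (cong₂ (adj G) πy≡x fixes-z)) (π-adj y z)))
      ... | inj₂ (inj₂ (πx≡y , refl)) =
        ⊥-elim (xz≢yz (trans (sym (π-adj x z)) (cong₂ (adj G) πx≡y fixes-z)))

chiD≡order⇒nonadjacentTwins : (G : Graph (suc m)) → IsChiD G (suc m) → NonadjacentTwins G
chiD≡order⇒nonadjacentTwins {m} G (_ , minimal) x y xy z with y ≟ x
... | yes refl = refl
... | no y≢x with adj G x z Bool.≟ adj G y z
...   | yes xz≡yz = xz≡yz
...   | no xz≢yz  = ⊥-elim (ℕ.n≮n m (minimal m (Merge.merged-colouring y≢x G xy z xz≢yz)))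

module _ {G : Graph m} {H : Graph n} where

  ∪-adj-join : ∀ u z → adj (G ∪ᵍ H) (join m n u) z ≡ unionAdj G H u (splitAt m z)
  ∪-adj-join u z = cong (λ t → unionAdj G H t (splitAt m z)) (splitAt-join m n u)

  ∪-adj-join₂ : ∀ u w → adj (G ∪ᵍ H) (join m n u) (join m n w) ≡ unionAdj G H u w
  ∪-adj-join₂ u w = trans (∪-adj-join u (join m n w)) (cong (unionAdj G H u) (splitAt-join m n w))

  ∪-twins : ∀ {u u′} → (∀ w → unionAdj G H u w ≡ unionAdj G H u′ w) →
            Twins (G ∪ᵍ H) (join m n u) (join m n u′)
  ∪-twins {u} {u′} twins z =
    trans (∪-adj-join u z) (trans (twins (splitAt m z)) (sym (∪-adj-join u′ z)))

  twins⇒∪-twinsˡ : ∀ {x y} → Twins G x y → Twins (G ∪ᵍ H) (x ↑ˡ n) (y ↑ˡ n)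
  twins⇒∪-twinsˡ {x} {y} twins = ∪-twins {inj₁ x} {inj₁ y} λ
    { (inj₁ z) → twins z
    ; (inj₂ _) → refl }

  twins⇒∪-twinsʳ : ∀ {x y} → Twins H x y → Twins (G ∪ᵍ H) (m ↑ʳ x) (m ↑ʳ y)
  twins⇒∪-twinsʳ {x} {y} twins = ∪-twins {inj₂ x} {inj₂ y} λ
    { (inj₁ _) → refl
    ; (inj₂ z) → twins z }

  involution-automorphism : (f : Fin m ⊎ Fin n → Fin m ⊎ Fin n) → (∀ u → f (f u) ≡ u) →
                            (∀ u w → unionAdj G H (f u) (f w) ≡ unionAdj G H u w) →
                            Automorphism (G ∪ᵍ H)
  involution-automorphism f f-involutive f-adj =
    permutation F F F-involutive F-involutive ,
    λ x y → trans (∪-adj-join₂ (f (splitAt m x)) (f (splitAt m y)))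
                  (f-adj (splitAt m x) (splitAt m y))
    where
    F : Fin (m + n) → Fin (m + n)
    F x = join m n (f (splitAt m x))
    F-involutive : ∀ x → F (F x) ≡ x
    F-involutive x = begin
      join m n (f (splitAt m (join m n (f (splitAt m x))))) ≡⟨ cong (join m n ∘ f) (splitAt-join m n _) ⟩
      join m n (f (f (splitAt m x)))                        ≡⟨ cong (join m n) (f-involutive _) ⟩
      join m n (splitAt m x)                                ≡⟨ join-splitAt m n x ⟩
      x                                                     ∎

module _ {G : Graph m} {H : Graph n} (D : DistColoring (G ∪ᵍ H) k) where
  open DistColoring D

  colour-injectiveˡ : NonadjacentTwins G → Injective _≡_ _≡_ (λ x → col (x ↑ˡ n))
  colour-injectiveˡ twins {x} {y} cx≡cy =
    ↑ˡ-injective n x y (twins-coloured-apart D (twins⇒∪-twinsˡ (twins x y xy)) cx≡cy)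
    where
    xy : adj G x y ≡ false
    xy = trans (sym (∪-adj-join₂ {G = G} {H = H} (inj₁ x) (inj₁ y))) (same-colour⇒nonadjacent D cx≡cy)

  colour-injectiveʳ : NonadjacentTwins H → Injective _≡_ _≡_ (λ y → col (m ↑ʳ y))
  colour-injectiveʳ twins {x} {y} cx≡cy =
    ↑ʳ-injective m x y (twins-coloured-apart D (twins⇒∪-twinsʳ (twins x y xy)) cx≡cy)
    where
    xy : adj H x y ≡ false
    xy = trans (sym (∪-adj-join₂ {G = G} {H = H} (inj₂ x) (inj₂ y))) (same-colour⇒nonadjacent D cx≡cy)

module OnSum {G : Graph m} {H : Graph n} (σ : Automorphism (G ∪ᵍ H)) where

  s : Fin m ⊎ Fin n → Fin m ⊎ Fin n
  s u = splitAt m (proj₁ σ ⟨$⟩ʳ join m n u)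

  s-adj : ∀ u w → unionAdj G H (s u) (s w) ≡ unionAdj G H u w
  s-adj u w = trans (proj₂ σ (join m n u) (join m n w)) (∪-adj-join₂ u w)

  s-injective : Injective _≡_ _≡_ s
  s-injective = join-injective ∘ permutation-injective (proj₁ σ) ∘ splitAt-injective

  s-preserves : (κ : Fin m ⊎ Fin n → Fin k) →
                (∀ x → κ (splitAt m (proj₁ σ ⟨$⟩ʳ x)) ≡ κ (splitAt m x)) → ∀ u → κ (s u) ≡ κ u
  s-preserves κ pres u = trans (pres (join m n u)) (cong κ (splitAt-join m n u))

  s-identity⇒identity : (∀ u → s u ≡ u) → ∀ x → proj₁ σ ⟨$⟩ʳ x ≡ x
  s-identity⇒identity fixed x = splitAt-injective (begin
    splitAt m (proj₁ σ ⟨$⟩ʳ x) ≡⟨ cong (λ t → splitAt m (proj₁ σ ⟨$⟩ʳ t)) (join-splitAt m n x) ⟨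
    s (splitAt m x)           ≡⟨ fixed (splitAt m x) ⟩
    splitAt m x               ∎)

  Crosses : Fin m → Set
  Crosses i = ∃ λ t → s (inj₁ i) ≡ inj₂ t

  crossing-propagates : ∀ {i j} → adj G i j ≡ true → Crosses i → Crosses j
  crossing-propagates {i} {j} ij (t , si) with s (inj₁ j) in sj
  ... | inj₂ t′ = t′ , refl
  ... | inj₁ _  = ⊥-elim (false≢true (begin
    false                                  ≡⟨ cong₂ (unionAdj G H) si sj ⟨
    unionAdj G H (s (inj₁ i)) (s (inj₁ j)) ≡⟨ s-adj (inj₁ i) (inj₁ j) ⟩
    adj G i j                              ≡⟨ ij ⟩
    true                                   ∎))

module TwoCopies {G : Graph n} {κ₁ κ₂ : Fin n → Fin k}
                 (κ₁-injective : Injective _≡_ _≡_ κ₁) (κ₂-injective : Injective _≡_ _≡_ κ₂) where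

  κ : Fin n ⊎ Fin n → Fin k
  κ = [ κ₁ , κ₂ ]′

  colour : Fin (n + n) → Fin k
  colour x = κ (splitAt n x)

  κ-proper : ∀ u w → unionAdj G G u w ≡ true → κ u ≢ κ w
  κ-proper (inj₁ x) (inj₁ y) xy = adj≡true⇒≢ G xy ∘ κ₁-injective
  κ-proper (inj₂ x) (inj₂ y) xy = adj≡true⇒≢ G xy ∘ κ₂-injective
  κ-proper (inj₁ _) (inj₂ _) ()
  κ-proper (inj₂ _) (inj₁ _) ()

  ColourPreserving : Automorphism (G ∪ᵍ G) → Set
  ColourPreserving σ = ∀ x → colour (proj₁ σ ⟨$⟩ʳ x) ≡ colour x

  module _ {σ : Automorphism (G ∪ᵍ G)} (pres : ColourPreserving σ) where
    open OnSum {G = G} {H = G} σ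

    s-colour : ∀ {u w} → s u ≡ w → κ w ≡ κ u
    s-colour {u} su≡w = trans (cong κ (sym su≡w)) (s-preserves κ pres u)

    crossing-lands : ∀ {i t w} → s (inj₁ i) ≡ inj₂ t → κ₂ w ≡ κ₁ i → s (inj₁ i) ≡ inj₂ w
    crossing-lands {i} si κ₂w≡κ₁i =
      trans si (cong inj₂ (κ₂-injective (trans (s-colour {inj₁ i} si) (sym κ₂w≡κ₁i))))

    no-crossing⇒identity : (∀ i → ¬ Crosses i) → ∀ x → proj₁ σ ⟨$⟩ʳ x ≡ x
    no-crossing⇒identity no-crossing = s-identity⇒identity fixed
      where
      fixedˡ : ∀ i → s (inj₁ i) ≡ inj₁ i
      fixedˡ i with s (inj₁ i) in si
      ... | inj₁ _ = cong inj₁ (κ₁-injective (s-colour {inj₁ i} si))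
      ... | inj₂ t = ⊥-elim (no-crossing i (t , si))

      fixedʳ : ∀ j → s (inj₂ j) ≡ inj₂ j
      fixedʳ j with s (inj₂ j) in sj
      ... | inj₂ _ = cong inj₂ (κ₂-injective (s-colour {inj₂ j} sj))
      ... | inj₁ i with s-injective {inj₂ j} {inj₁ i} (trans sj (sym (fixedˡ i)))
      ...   | ()

      fixed : ∀ u → s u ≡ u
      fixed (inj₁ i) = fixedˡ i
      fixed (inj₂ j) = fixedʳ j

  two-copy-colouring : StrictlySurjective _≡_ κ →
                       (∀ σ → ColourPreserving σ → ∀ i → ¬ OnSum.Crosses σ i) →
                       DistColoring (G ∪ᵍ G) k
  two-copy-colouring κ-surjective no-crossing = record
    { col            = colour
    ; surjective     = λ i → let (u , κu≡i) = κ-surjective i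
                             in join n n u , trans (cong κ (splitAt-join n n u)) κu≡i
    ; proper         = λ x y → κ-proper (splitAt n x) (splitAt n y)
    ; distinguishing = λ σ pres → no-crossing⇒identity {σ = σ} pres (no-crossing σ pres)
    }

module _ {G : Graph n} (φ : Automorphism G) where

  exchange : Fin n ⊎ Fin n → Fin n ⊎ Fin n
  exchange (inj₁ x) = inj₂ (proj₁ φ ⟨$⟩ʳ x)
  exchange (inj₂ y) = inj₁ (proj₁ φ ⟨$⟩ˡ y)

  exchange-involutive : ∀ u → exchange (exchange u) ≡ u
  exchange-involutive (inj₁ x) = cong inj₁ (inverseˡ (proj₁ φ))
  exchange-involutive (inj₂ y) = cong inj₂ (inverseʳ (proj₁ φ))

  exchange-adj : ∀ u w → unionAdj G G (exchange u) (exchange w) ≡ unionAdj G G u w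
  exchange-adj (inj₁ x) (inj₁ y) = proj₂ φ x y
  exchange-adj (inj₂ x) (inj₂ y) =
    trans (sym (proj₂ φ (φ⁻¹ x) (φ⁻¹ y))) (cong₂ (adj G) (inverseʳ (proj₁ φ)) (inverseʳ (proj₁ φ)))
    where φ⁻¹ = proj₁ φ ⟨$⟩ˡ_
  exchange-adj (inj₁ _) (inj₂ _) = refl
  exchange-adj (inj₂ _) (inj₁ _) = refl

  exchange-automorphism : Automorphism (G ∪ᵍ G)
  exchange-automorphism = involution-automorphism exchange exchange-involutive exchange-adj

complete-adj : ∀ {x y : Fin n} → x ≢ y → adj (complete n) x y ≡ true
complete-adj {x = x} {y} x≢y with x ≟ y
... | yes x≡y = ⊥-elim (x≢y x≡y)
... | no _    = refl

module _ {G : Graph n} (G≅K : G ≅ᵍ complete n) where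

  ≅complete⇒adj : ∀ {x y} → x ≢ y → adj G x y ≡ true
  ≅complete⇒adj {x} {y} x≢y =
    trans (sym (proj₂ G≅K x y)) (complete-adj (x≢y ∘ permutation-injective (proj₁ G≅K)))

  ≅complete⇒nonadjacentTwins : NonadjacentTwins G
  ≅complete⇒nonadjacentTwins x y xy z with x ≟ y
  ... | yes refl = refl
  ... | no x≢y   = ⊥-elim (false≢true (trans (sym xy) (≅complete⇒adj x≢y)))

  ≅complete⇒automorphism : Permutation′ n → Automorphism G
  ≅complete⇒automorphism π = π , preserves
    where
    preserves : ∀ x y → adj G (π ⟨$⟩ʳ x) (π ⟨$⟩ʳ y) ≡ adj G x y
    preserves x y with x ≟ y
    ... | yes refl = trans (irrefl G (π ⟨$⟩ʳ x)) (sym (irrefl G x))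
    ... | no x≢y   =
      trans (≅complete⇒adj (x≢y ∘ permutation-injective π)) (sym (≅complete⇒adj x≢y))

module CompleteUnion {G : Graph (suc m)} (G≅K : G ≅ᵍ complete (suc m)) where

  twins : NonadjacentTwins G
  twins = ≅complete⇒nonadjacentTwins {G = G} G≅K

  no-order-colouring : ¬ DistColoring (G ∪ᵍ G) (suc m)
  no-order-colouring D = inj₂≢inj₁ (begin
    inj₂ (proj₁ φ ⟨$⟩ʳ zero)           ≡⟨ splitAt-join (suc m) (suc m) (inj₂ _) ⟨
    splitAt (suc m) (proj₁ ε ⟨$⟩ʳ zero) ≡⟨ cong (splitAt (suc m)) (distinguishing ε pres zero) ⟩
    inj₁ zero                          ∎)
    where
    open DistColoring D
    ρ₁ ρ₂ : Permutation′ (suc m)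
    ρ₁ = injective⇒permutation (colour-injectiveˡ {G = G} {H = G} D twins)
    ρ₂ = injective⇒permutation (colour-injectiveʳ {G = G} {H = G} D twins)
    φ : Automorphism G
    φ = ≅complete⇒automorphism {G = G} G≅K (ρ₁ ∘ₚ flip ρ₂)
    ε : Automorphism (G ∪ᵍ G)
    ε = exchange-automorphism φ
    exchange-preserves : ∀ u → col (join (suc m) (suc m) (exchange {G = G} φ u)) ≡
                               col (join (suc m) (suc m) u)
    exchange-preserves (inj₁ x) = inverseʳ ρ₂
    exchange-preserves (inj₂ y) = inverseʳ ρ₁
    pres : ∀ x → col (proj₁ ε ⟨$⟩ʳ x) ≡ col x
    pres x =
      trans (exchange-preserves (splitAt (suc m) x)) (cong col (join-splitAt (suc m) (suc m) x))
    inj₂≢inj₁ : ∀ {y x : Fin (suc m)} → inj₂ y ≢ inj₁ x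
    inj₂≢inj₁ ()

  open TwoCopies {G = G} {κ₁ = inject₁} {κ₂ = suc} inject₁-injective suc-injective

  zero-stays : ∀ σ → ColourPreserving σ → ¬ OnSum.Crosses σ zero
  zero-stays σ pres (t , s0) with s-colour {σ = σ} pres {inj₁ zero} s0
  ... | ()

  order+1-colouring : DistColoring (G ∪ᵍ G) (suc (suc m))
  order+1-colouring = two-copy-colouring surjective no-crossing
    where
    surjective : StrictlySurjective _≡_ κ
    surjective zero    = inj₁ zero , refl
    surjective (suc j) = inj₂ j , refl
    no-crossing : ∀ σ → ColourPreserving σ → ∀ i → ¬ OnSum.Crosses σ i
    no-crossing σ pres i crosses with i ≟ zero
    ... | yes refl = zero-stays σ pres crosses
    ... | no i≢0   =
      zero-stays σ pres (OnSum.crossing-propagates σ (≅complete⇒adj {G = G} G≅K i≢0) crosses)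

  ∪-chiD : IsChiD (G ∪ᵍ G) (suc m + 1)
  ∪-chiD = subst (DistColoring (G ∪ᵍ G)) (ℕ.+-comm 1 (suc m)) order+1-colouring , lower-bound
    where
    lower-bound : ∀ k → DistColoring (G ∪ᵍ G) k → suc m + 1 ≤ k
    lower-bound k D with suc m ℕ.≟ k
    ... | yes refl = ⊥-elim (no-order-colouring D)
    ... | no m+1≢k = subst (_≤ k) (ℕ.+-comm 1 (suc m))
      (ℕ.≤∧≢⇒< (injective⇒≤ (colour-injectiveˡ {G = G} {H = G} D twins)) m+1≢k)

edgeless⇒chiD : (K : Graph n) → (∀ x y → adj K x y ≡ false) → IsChiD K n
edgeless⇒chiD K no-edges = identity , λ k D → injective⇒≤ (twins-coloured-apart D (all-twins _ _))
  where
  all-twins : ∀ x y → Twins K x y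
  all-twins x y z = trans (no-edges x z) (sym (no-edges y z))
  identity : DistColoring K _
  identity = record
    { col            = λ x → x
    ; surjective     = λ i → i , refl
    ; proper         = λ x y xy _ → false≢true (trans (sym (no-edges x y)) xy)
    ; distinguishing = λ σ pres → pres
    }

≅edgeless⇒no-edges : {G : Graph n} → G ≅ᵍ edgeless n → ∀ x y → adj G x y ≡ false
≅edgeless⇒no-edges G≅E x y = sym (proj₂ G≅E x y)

∪-edgeless : {G : Graph m} {H : Graph n} →
             (∀ x y → adj G x y ≡ false) → (∀ x y → adj H x y ≡ false) →
             ∀ x y → adj (G ∪ᵍ H) x y ≡ false
∪-edgeless {m} {G = G} {H} G-edgeless H-edgeless x y = go (splitAt m x) (splitAt m y)
  where
  go : ∀ u w → unionAdj G H u w ≡ false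
  go (inj₁ x) (inj₁ y) = G-edgeless x y
  go (inj₂ x) (inj₂ y) = H-edgeless x y
  go (inj₁ _) (inj₂ _) = refl
  go (inj₂ _) (inj₁ _) = refl

¬≅complete⇒nonedge : (G : Graph n) → ¬ (G ≅ᵍ complete n) → ∃₂ λ a b → a ≢ b × adj G a b ≡ false
¬≅complete⇒nonedge {n} G G≇K
  with any? (λ a → any? λ b → ¬? (a ≟ b) ×-dec (adj G a b Bool.≟ false))
... | yes nonedge = nonedge
... | no none     = ⊥-elim (G≇K (id , is-complete))
  where
  is-complete : ∀ x y → adj (complete n) x y ≡ adj G x y
  is-complete x y with x ≟ y
  ... | yes refl = sym (irrefl G x)
  ... | no x≢y with adj G x y in xy
  ...   | true  = refl
  ...   | false = ⊥-elim (none (x , y , x≢y , xy))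

¬≅edgeless⇒edge : (G : Graph n) → ¬ (G ≅ᵍ edgeless n) → ∃₂ λ a b → adj G a b ≡ true
¬≅edgeless⇒edge {n} G G≇E with any? (λ a → any? λ b → adj G a b Bool.≟ true)
... | yes edge = edge
... | no none   = ⊥-elim (G≇E (id , is-edgeless))
  where
  is-edgeless : ∀ x y → false ≡ adj G x y
  is-edgeless x y with adj G x y in xy
  ... | false = refl
  ... | true  = ⊥-elim (none (x , y , xy))

edge⇒no-isolated-vertex : {G : Graph n} → NonadjacentTwins G → ∀ {x y} → adj G x y ≡ true →
                          ∀ a → ∃ λ v → adj G a v ≡ true
edge⇒no-isolated-vertex {G = G} twins {x} {y} xy a with adj G a x in ax
... | true  = x , ax
... | false = y , trans (twins a x ax y) xy

module GeneralUnion {G : Graph n} (twins : NonadjacentTwins G) {a b v : Fin n}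
                    (a≢b : a ≢ b) (ab : adj G a b ≡ false) (av : adj G a v ≡ true) where

  τ : Permutation′ n
  τ = transpose a v

  open TwoCopies {G = G} {κ₁ = λ x → x} {κ₂ = τ ⟨$⟩ʳ_} (λ e → e) (permutation-injective τ)

  vb : adj G v b ≡ true
  vb = trans (Graph.sym G v b) (trans (sym (twins a b ab v)) av)

  b≢v : b ≢ v
  b≢v refl = false≢true (trans (sym ab) av)

  no-crossing : ∀ σ → ColourPreserving σ → ∀ i → ¬ OnSum.Crosses σ i
  no-crossing σ pres i crosses = false≢true (begin
    false                                  ≡⟨ ab ⟨
    adj G a b                              ≡⟨ s-adj (inj₁ a) (inj₁ b) ⟨
    unionAdj G G (s (inj₁ a)) (s (inj₁ b)) ≡⟨ cong₂ (unionAdj G G) a↦v b↦b ⟩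
    adj G v b                              ≡⟨ vb ⟩
    true                                   ∎)
    where
    open OnSum {G = G} {H = G} σ
    a-crosses : Crosses a
    a-crosses with adj G i a in ia
    ... | true  = crossing-propagates ia crosses
    ... | false = crossing-propagates (trans (Graph.sym G v a) av)
                    (crossing-propagates (trans (twins i a ia v) av) crosses)
    b-crosses : Crosses b
    b-crosses = crossing-propagates vb (crossing-propagates av a-crosses)
    a↦v : s (inj₁ a) ≡ inj₂ v
    a↦v = crossing-lands {σ = σ} pres (proj₂ a-crosses) (transpose-q {p = a} {q = v})
    b↦b : s (inj₁ b) ≡ inj₂ b
    b↦b = crossing-lands {σ = σ} pres (proj₂ b-crosses) (transpose-other (a≢b ∘ sym) b≢v)

  ∪-chiD : IsChiD (G ∪ᵍ G) n
  ∪-chiD = two-copy-colouring (λ i → inj₁ i , refl) no-crossing ,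
           λ k D → injective⇒≤ (colour-injectiveˡ {G = G} {H = G} D twins)

theorem5p8 : (n : ℕ) → n ≥ 1 → (G : Graph n) → IsChiD G n →
    ((G ≅ᵍ complete n → IsChiD (G ∪ᵍ G) (n + 1))
    × (G ≅ᵍ edgeless n → IsChiD (G ∪ᵍ G) (2 * n))
    × (¬ (G ≅ᵍ complete n) → ¬ (G ≅ᵍ edgeless n) → IsChiD (G ∪ᵍ G) n))
theorem5p8 0 () _ _
theorem5p8 (suc m) _ G χ = complete-case , edgeless-case , general-case
  where
  complete-case : G ≅ᵍ complete (suc m) → IsChiD (G ∪ᵍ G) (suc m + 1)
  complete-case G≅K = CompleteUnion.∪-chiD {G = G} G≅K

  edgeless-case : G ≅ᵍ edgeless (suc m) → IsChiD (G ∪ᵍ G) (2 * suc m)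
  edgeless-case G≅E = subst (IsChiD (G ∪ᵍ G)) (cong (suc m +_) (sym (ℕ.+-identityʳ (suc m))))
    (edgeless⇒chiD (G ∪ᵍ G) (∪-edgeless no-edges no-edges))
    where no-edges = ≅edgeless⇒no-edges {G = G} G≅E

  general-case : ¬ (G ≅ᵍ complete (suc m)) → ¬ (G ≅ᵍ edgeless (suc m)) → IsChiD (G ∪ᵍ G) (suc m)
  general-case G≇K G≇E =
    let twins              = chiD≡order⇒nonadjacentTwins G χ
        (a , b , a≢b , ab) = ¬≅complete⇒nonedge G G≇K
        (x , y , xy)       = ¬≅edgeless⇒edge G G≇E
        (v , av)           = edge⇒no-isolated-vertex {G = G} twins xy a
    in GeneralUnion.∪-chiD {G = G} twins a≢b ab av
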